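{- Let $T=(V,E)$ be a finite tree, $\mathcal{M}\in\{\mathcal{MIN},\mathcal{MAJ}\}$, $c\in\mathcal{C}^2_{\mathcal{M}}(T)$, and let $e=(u,w)$ be an edge of the block tree $\mathcal{B}_c(T)$. Then: (1) if $\deg_T(u)=2$ then $u$ is a fixed node of $c$; (2) $\min(\deg_T(u),\deg_T(w))\ge 2$ and $\max(\deg_T(u),\deg_T(w))\ge 3$; (3) if $T_0$ is a node of $\mathcal{B}_c(T)$, $v\in T_0$, $\deg_{T_0}(v)=1$ and $\deg_T(v)$ is even, then $v$ is a fixed node and $T_0$ is a fixed block; (4) if $T_0=\{v\}$ is a node of $\mathcal{B}_c(T)$ then $v$ is a fixed node, $T_0$ is a fixed block, and $\deg_T(v)$ is even.
   Context: Colorings are maps $c:V\to\{0,1\}$; $N^i(v)$ is the set of neighbors of $v$ with color $i$. $\mathcal{MIN}(c)(v)=c(v)$ if $|N^{c(v)}(v)|\le|N^{1-c(v)}(v)|$, else $1-c(v)$; $\mathcal{MAJ}(c)(v)=c(v)$ if $|N^{c(v)}(v)|\ge|N^{1-c(v)}(v)|$, else $1-c(v)$ (simultaneous update). $\mathcal{C}^2_{\mathcal{M}}(T)$ is the set of colorings $c$ with $\mathcal{M}(c)\ne c$ and $\mathcal{M}(\mathcal{M}(c))=c$. For such $c$, a node $u$ is a fixed node if $\mathcal{M}(c)(u)=c(u)$ and a toggle node otherwise. $T^f$ (resp. $T^t$) is the subgraph of $T$ induced by the fixed (resp. toggle) nodes. The block tree $\mathcal{B}_c(T)$ has as nodes the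 connected components $T_1,\dots,T_s$ of $T^f$ and of $T^t$; $T_i$ and $T_j$ are adjacent iff some edge $(x,y)\in E$ has $x\in T_i$, $y\in T_j$, and this edge of $T$ is identified with the corresponding edge of $\mathcal{B}_c(T)$. A node of $\mathcal{B}_c(T)$ is a fixed block if it is a component of $T^f$ and a toggle block if it is a component of $T^t$. $\deg_{T_0}(v)$ denotes the degree of $v$ in the subtree $T_0$. -}

module Defs where

open import Data.Nat using (ℕ; _≤_; _≤?_; _⊓_; _⊔_)
open import Data.Nat.Divisibility using (_∣_)
open import Data.Fin using (Fin)
open import Data.Fin.Properties using () renaming (_≟_ to _≟F_)
open import Data.Bool using (Bool; true; false; not; _∧_; if_then_else_; T)
open import Data.Bool.Properties using () renaming (_≟_ to _≟B_)
open import Data.List using (List; []; _∷_; length; filterᵇ; allFin; _∷ʳ_)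
open import Data.List.Relation.Unary.Unique.Propositional using (Unique)
open import Data.Product using (Σ; ∃; _×_)
open import Data.Unit using (⊤)
open import Data.Empty using (⊥)
open import Relation.Nullary using (¬_)
open import Relation.Nullary.Decidable using (⌊_⌋)
open import Relation.Binary.PropositionalEquality using (_≡_)

record Graph (n : ℕ) : Set where
  field
    adj    : Fin n → Fin n → Bool
    adjSym : ∀ x y → adj x y ≡ adj y x
    irrefl : ∀ x → adj x x ≡ false
open Graph public

module _ {n : ℕ} (G : Graph n) where

  cnt : (Fin n → Bool) → ℕ
  cnt f = length (filterᵇ f (allFin n))

  deg : Fin n → ℕ
  deg v = cnt (adj G v)

  data WalkIn (S : Fin n → Bool) : Fin n → Fin n → Set where
    here : ∀ {x} → T (S x) → WalkIn S x x
    step : ∀ {x y z} → T (S x) → T (adj G x y) → WalkIn S y z → WalkIn S x z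

  Connected : Set
  Connected = ∀ x y → WalkIn (λ _ → true) x y

  Chain : List (Fin n) → Set
  Chain [] = ⊤
  Chain (x ∷ []) = ⊤
  Chain (x ∷ y ∷ r) = T (adj G x y) × Chain (y ∷ r)

  Cycle : Set
  Cycle = Σ (Fin n) λ x → Σ (List (Fin n)) λ rest →
            (2 ≤ length rest) × Unique (x ∷ rest) × Chain ((x ∷ rest) ∷ʳ x)

  IsTree : Set
  IsTree = Connected × ¬ Cycle

Coloring : ℕ → Set
Coloring n = Fin n → Bool

data Rule : Set where
  MIN MAJ : Rule

module _ {n : ℕ} (G : Graph n) where

  Ncol : Coloring n → Fin n → Bool → ℕ
  Ncol c v i = cnt G (λ w → adj G v w ∧ ⌊ c w ≟B i ⌋)

  apply : Rule → Coloring n → Coloring n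
  apply MIN c v = if ⌊ Ncol c v (c v) ≤? Ncol c v (not (c v)) ⌋ then c v else not (c v)
  apply MAJ c v = if ⌊ Ncol c v (not (c v)) ≤? Ncol c v (c v) ⌋ then c v else not (c v)

  InC2 : Rule → Coloring n → Set
  InC2 M c = ¬ (∀ v → apply M c v ≡ c v) × (∀ v → apply M (apply M c) v ≡ c v)

  Fixed : Rule → Coloring n → Fin n → Set
  Fixed M c u = apply M c u ≡ c u

  -- Boolean status: true = fixed node, false = toggle node
  status : Rule → Coloring n → Fin n → Bool
  status M c u = ⌊ apply M c u ≟B c u ⌋

  -- S (a vertex set) is a node of the block tree B_c(T): a connected component
  -- of T^f or of T^t, i.e. nonempty, all of one status, connected inside S,
  -- and closed under adjacent vertices of the same status.
  IsBlock : Rule → Coloring n → (Fin n → Bool) → Set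
  IsBlock M c S =
    (∃ λ x → T (S x)) ×
    (∀ x y → T (S x) → T (S y) → status M c x ≡ status M c y) ×
    (∀ x y → T (S x) → T (S y) → WalkIn G S x y) ×
    (∀ x y → T (S x) → T (adj G x y) → status M c x ≡ status M c y → T (S y))

  FixedBlock : Rule → Coloring n → (Fin n → Bool) → Set
  FixedBlock M c S = ∀ x → T (S x) → Fixed M c x

  degIn : (Fin n → Bool) → Fin n → ℕ
  degIn S v = cnt G (λ w → adj G v w ∧ S w)

  -- (u , w) is an edge of the block tree B_c(T) (identified with the T-edge)
  -- joining the distinct blocks S₁ ∋ u and S₂ ∋ w
  BlockEdge : Rule → Coloring n → (Fin n → Bool) → (Fin n → Bool) → Fin n → Fin n → Set
  BlockEdge M c S₁ S₂ u w =
    IsBlock M c S₁ × IsBlock M c S₂ × ¬ (∀ x → S₁ x ≡ S₂ x) ×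
    T (S₁ u) × T (S₂ w) × T (adj G u w)

-- Split the neighbours of a node v by status (fixed/toggle) and colour.  Fixed neighbours keep
-- their colour in M(c) and toggle neighbours flip it, so the colour counts around v in c and in
-- M(c) are sums of the same four numbers, with the two toggle counts exchanged.  As M(M(c)) = c,
-- v makes the same kind of decision (keep or flip) in c and in M(c).  For a fixed v without fixed
-- neighbours the two decisions force equally many toggle neighbours of each colour, so deg v is
-- even; for a toggle v with at most one toggle neighbour they force exactly one toggle neighbour
-- and equally many fixed neighbours of each colour, so deg v is odd.  All four claims follow by
-- counting neighbours of equal status.
module Submission where

open import Defs
open import Data.Nat using (ℕ; zero; suc; _+_; _≤_; _<_; _⊓_; _⊔_; _≤?_; z≤n; s≤s; s≤s⁻¹)
open import Data.Nat.Properties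
open import Data.Nat.Divisibility using (_∣_; m∣m*n; ∣m+n∣m⇒∣n; ∣1⇒≡1)
open import Data.Fin using (Fin)
open import Data.Bool using (Bool; true; false; not; _∧_; if_then_else_; T)
open import Data.Bool.Properties
  using ( ∧-assoc; ∧-commutativeMonoid; ∧-zeroʳ; not-involutive; ¬-not; not-¬
        ; T-≡; T-not-≡; T-∧; ⇔→≡)
  renaming (_≟_ to _≟B_)
open import Data.List using ([]; _∷_; length; filterᵇ; allFin)
open import Data.List.Relation.Unary.Any using (here; there)
open import Data.List.Membership.Propositional using (_∈_)
open import Data.List.Membership.Propositional.Properties using (∈-allFin)
open import Data.Product using (_×_; _,_; proj₁; proj₂)
open import Data.Empty using (⊥-elim)
open import Function.Base using (_∘_)
open import Function.Bundles using (_⇔_; mk⇔; Equivalence)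
open import Relation.Nullary using (¬_; Dec; yes; no)
open import Relation.Nullary.Decidable
  using (⌊_⌋; toWitness; fromWitness; fromWitnessFalse; decidable-stable)
open import Relation.Binary.PropositionalEquality
open import Algebra.Bundles using (CommutativeMonoid)
open import Algebra.Properties.CommutativeSemigroup
  (CommutativeMonoid.commutativeSemigroup ∧-commutativeMonoid) using (xy∙z≈xz∙y)

≟-not : ∀ x y → not ⌊ x ≟B y ⌋ ≡ ⌊ x ≟B not y ⌋
≟-not true  true  = refl
≟-not true  false = refl
≟-not false true  = refl
≟-not false false = refl

module _ {A : Set} where

  length-filterᵇ-cong : {f g : A → Bool} → (∀ x → f x ≡ g x) →
                        ∀ xs → length (filterᵇ f xs) ≡ length (filterᵇ g xs)
  length-filterᵇ-cong         f≗g []       = refl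
  length-filterᵇ-cong {f} {g} f≗g (x ∷ xs) with f x | g x | f≗g x
  ... | true  | .true  | refl = cong suc (length-filterᵇ-cong f≗g xs)
  ... | false | .false | refl = length-filterᵇ-cong f≗g xs

  length-filterᵇ-split : ∀ (f g : A → Bool) xs →
    length (filterᵇ f xs) ≡
    length (filterᵇ (λ x → f x ∧ g x) xs) + length (filterᵇ (λ x → f x ∧ not (g x)) xs)
  length-filterᵇ-split f g [] = refl
  length-filterᵇ-split f g (x ∷ xs) with f x | g x
  ... | true  | true  = cong suc (length-filterᵇ-split f g xs)
  ... | true  | false = trans (cong suc (length-filterᵇ-split f g xs)) (sym (+-suc _ _))
  ... | false | _     = length-filterᵇ-split f g xs

  length-filterᵇ-pos : ∀ (f : A → Bool) {x xs} → x ∈ xs → T (f x) → 1 ≤ length (filterᵇ f xs)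
  length-filterᵇ-pos f {xs = y ∷ _}  (here refl) fx with f y
  ... | true = s≤s z≤n
  length-filterᵇ-pos f {xs = y ∷ _}  (there x∈) fx with f y
  ... | true  = s≤s z≤n
  ... | false = length-filterᵇ-pos f x∈ fx

  length-filterᵇ-none : ∀ {f : A → Bool} → (∀ x → f x ≡ false) →
                        ∀ xs → length (filterᵇ f xs) ≡ 0
  length-filterᵇ-none     f≗false []       = refl
  length-filterᵇ-none {f} f≗false (x ∷ xs) with f x | f≗false x
  ... | false | refl = length-filterᵇ-none f≗false xs

  length-filterᵇ-split-≟ : ∀ (f : A → Bool) (g : A → Bool) b xs →
    length (filterᵇ f xs) ≡
    length (filterᵇ (λ x → f x ∧ ⌊ g x ≟B b ⌋) xs) +
    length (filterᵇ (λ x → f x ∧ ⌊ g x ≟B not b ⌋) xs)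
  length-filterᵇ-split-≟ f g b xs =
    trans (length-filterᵇ-split f (λ x → ⌊ g x ≟B b ⌋) xs)
          (cong₂ _+_ refl (length-filterᵇ-cong (λ x → cong (f x ∧_) (≟-not (g x) b)) xs))

-- x and x′ are the colours of a node in c and in M(c), and s is its status.
recolour : ∀ x x′ i s → ⌊ ⌊ x′ ≟B x ⌋ ≟B s ⌋ ∧ ⌊ x′ ≟B i ⌋
                      ≡ ⌊ ⌊ x′ ≟B x ⌋ ≟B s ⌋ ∧ ⌊ x ≟B (if s then i else not i) ⌋
recolour true  true  i     true  = refl
recolour false false i     true  = refl
recolour true  false true  false = refl
recolour true  false false false = refl
recolour false true  true  false = refl
recolour false true  false false = refl
recolour true  true  _     false = refl
recolour false false _     false = refl
recolour true  false _     true  = refl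
recolour false true  _     true  = refl

∧-congˡ-T : ∀ {a b b′} → (T a → b ≡ b′) → a ∧ b ≡ a ∧ b′
∧-congˡ-T {false} _  = refl
∧-congˡ-T {true}  eq = eq _

T-⇔⇒≡ : ∀ {a b} → (T a → T b) → (T b → T a) → a ≡ b
T-⇔⇒≡ to from = ⇔→≡ {z = true}
  (mk⇔ (λ a≡ → Equivalence.to T-≡ (to (Equivalence.from T-≡ a≡)))
       (λ b≡ → Equivalence.to T-≡ (from (Equivalence.from T-≡ b≡))))

even-double : ∀ m → 2 ∣ m + m
even-double m = subst (2 ∣_) (cong (m +_) (+-identityʳ m)) (m∣m*n m)

odd-suc-double : ∀ m → ¬ 2 ∣ suc (m + m)
odd-suc-double m 2∣ with ∣1⇒≡1 (∣m+n∣m⇒∣n (subst (2 ∣_) (+-comm 1 (m + m)) 2∣) (even-double m))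
... | ()

Keeps : Rule → ℕ → ℕ → Set
Keeps MAJ same other = other ≤ same
Keeps MIN same other = same ≤ other

Keeps-antisym : ∀ M {a b} → Keeps M a b → Keeps M b a → a ≡ b
Keeps-antisym MAJ b≤a a≤b = ≤-antisym a≤b b≤a
Keeps-antisym MIN a≤b b≤a = ≤-antisym a≤b b≤a

Keeps-crossed : ∀ M {p q x y} → Keeps M (p + x) (q + y) → Keeps M (q + x) (p + y) → x ≡ y → p ≡ q
Keeps-crossed M {p} {q} {x} h₁ h₂ refl = +-cancelʳ-≡ x p q (Keeps-antisym M h₁ h₂)

crossed-< : ∀ p q {x y} → p + x < q + y → p + y < q + x → p + q ≤ 1 → x ≡ y × p + q ≡ 1
crossed-< zero          zero          x<y y<x _         = ⊥-elim (<-asym x<y y<x)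
crossed-< zero          (suc zero)    x<y y<x _         = ≤-antisym (s≤s⁻¹ x<y) (s≤s⁻¹ y<x) , refl
crossed-< (suc zero)    zero          x<y y<x _         =
  ⊥-elim (<-asym (<-trans (n<1+n _) x<y) (<-trans (n<1+n _) y<x))
crossed-< zero          (suc (suc q)) _   _   (s≤s ())
crossed-< (suc zero)    (suc q)       _   _   (s≤s ())
crossed-< (suc (suc p)) q             _   _   (s≤s ())

¬Keeps-crossed : ∀ M {p q x y} → ¬ Keeps M (p + x) (q + y) → ¬ Keeps M (p + y) (q + x) →
                 p + q ≤ 1 → x ≡ y × p + q ≡ 1
¬Keeps-crossed MAJ {p} {q} h₁ h₂ p+q≤1 = crossed-< p q (≰⇒> h₁) (≰⇒> h₂) p+q≤1
¬Keeps-crossed MIN {p} {q} h₁ h₂ p+q≤1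
  with y≡x , q+p≡1 ← crossed-< q p (≰⇒> h₁) (≰⇒> h₂) (subst (_≤ 1) (+-comm p q) p+q≤1)
  = sym y≡x , trans (+-comm p q) q+p≡1

module _ {P : Set} where

  if-dec-same : ∀ (k : Dec P) b → (if ⌊ k ⌋ then b else not b) ≡ b → P
  if-dec-same (yes p) _ _  = p
  if-dec-same (no _)  b eq = ⊥-elim (not-¬ eq refl)

  if-dec-flip : ∀ (k : Dec P) b → (if ⌊ k ⌋ then b else not b) ≢ b → ¬ P
  if-dec-flip (yes _) _ ≢b _ = ≢b refl
  if-dec-flip (no ¬p) _ _    = ¬p

module _ {n} (G : Graph n) where

  Fixed⇒Keeps : ∀ M (d : Coloring n) v → Fixed G M d v →
                Keeps M (Ncol G d v (d v)) (Ncol G d v (not (d v)))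
  Fixed⇒Keeps MAJ d v = if-dec-same _ (d v)
  Fixed⇒Keeps MIN d v = if-dec-same _ (d v)

  ¬Fixed⇒¬Keeps : ∀ M (d : Coloring n) v → ¬ Fixed G M d v →
                  ¬ Keeps M (Ncol G d v (d v)) (Ncol G d v (not (d v)))
  ¬Fixed⇒¬Keeps MAJ d v = if-dec-flip _ (d v)
  ¬Fixed⇒¬Keeps MIN d v = if-dec-flip _ (d v)

module _ {n} (G : Graph n) (M : Rule) (c : Coloring n) where

  private
    c′ : Coloring n
    c′ = apply G M c

    st : Fin n → Bool
    st = status G M c

  statusDeg : Fin n → Bool → ℕ
  statusDeg v s = cnt G (λ w → adj G v w ∧ ⌊ st w ≟B s ⌋)

  sameStatusDeg : Fin n → ℕ
  sameStatusDeg v = statusDeg v (st v)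

  deg-by-status : ∀ v s → deg G v ≡ statusDeg v s + statusDeg v (not s)
  deg-by-status v s = length-filterᵇ-split-≟ (adj G v) st s (allFin n)

  module _ (v : Fin n) where

    nbrs : Bool → Bool → ℕ
    nbrs s i = cnt G (λ w → (adj G v w ∧ ⌊ st w ≟B s ⌋) ∧ ⌊ c w ≟B i ⌋)

    statusDeg-by-colour : ∀ s i → statusDeg v s ≡ nbrs s i + nbrs s (not i)
    statusDeg-by-colour s i =
      length-filterᵇ-split-≟ (λ w → adj G v w ∧ ⌊ st w ≟B s ⌋) c i (allFin n)

    Ncol-before : ∀ i → Ncol G c v i ≡ nbrs false i + nbrs true i
    Ncol-before i =
      trans (length-filterᵇ-split-≟ (λ w → adj G v w ∧ ⌊ c w ≟B i ⌋) st false (allFin n))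
            (cong₂ _+_ (length-filterᵇ-cong (λ w → xy∙z≈xz∙y (adj G v w) _ _) (allFin n))
                       (length-filterᵇ-cong (λ w → xy∙z≈xz∙y (adj G v w) _ _) (allFin n)))

    Ncol-after : ∀ i → Ncol G c′ v i ≡ nbrs false (not i) + nbrs true i
    Ncol-after i =
      trans (length-filterᵇ-split-≟ (λ w → adj G v w ∧ ⌊ c′ w ≟B i ⌋) st false (allFin n))
            (cong₂ _+_ (length-filterᵇ-cong (regroup false) (allFin n))
                       (length-filterᵇ-cong (regroup true) (allFin n)))
      where
      regroup : ∀ s w → (adj G v w ∧ ⌊ c′ w ≟B i ⌋) ∧ ⌊ st w ≟B s ⌋
                      ≡ (adj G v w ∧ ⌊ st w ≟B s ⌋) ∧ ⌊ c w ≟B (if s then i else not i) ⌋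
      regroup s w = begin
        (adj G v w ∧ ⌊ c′ w ≟B i ⌋) ∧ ⌊ st w ≟B s ⌋
          ≡⟨ xy∙z≈xz∙y (adj G v w) _ _ ⟩
        (adj G v w ∧ ⌊ st w ≟B s ⌋) ∧ ⌊ c′ w ≟B i ⌋
          ≡⟨ ∧-assoc (adj G v w) _ _ ⟩
        adj G v w ∧ (⌊ st w ≟B s ⌋ ∧ ⌊ c′ w ≟B i ⌋)
          ≡⟨ cong (adj G v w ∧_) (recolour (c w) (c′ w) i s) ⟩
        adj G v w ∧ (⌊ st w ≟B s ⌋ ∧ ⌊ c w ≟B _ ⌋)
          ≡⟨ ∧-assoc (adj G v w) _ _ ⟨
        (adj G v w ∧ ⌊ st w ≟B s ⌋) ∧ ⌊ c w ≟B _ ⌋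
          ∎
        where open ≡-Reasoning

    Ncol-after-not : ∀ i → Ncol G c′ v (not i) ≡ nbrs false i + nbrs true (not i)
    Ncol-after-not i =
      trans (Ncol-after (not i)) (cong (λ j → nbrs false j + nbrs true (not i)) (not-involutive i))

    Fixed⇒status : Fixed G M c v → st v ≡ true
    Fixed⇒status fixed = Equivalence.to T-≡ (fromWitness fixed)

    ¬Fixed⇒status : ¬ Fixed G M c v → st v ≡ false
    ¬Fixed⇒status toggle = Equivalence.to T-not-≡ (fromWitnessFalse toggle)

    module _ (period : apply G M c′ v ≡ c v) where

      fixed⇒even-deg : Fixed G M c v → sameStatusDeg v ≡ 0 → 2 ∣ deg G v
      fixed⇒even-deg fixed noFixedNbr = subst (2 ∣_) (sym deg≡) (even-double (nbrs false b))
        where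
        b : Bool
        b = c v
        fixedNbrs≡0 : nbrs true b + nbrs true (not b) ≡ 0
        fixedNbrs≡0 = trans (sym (statusDeg-by-colour true b))
                            (subst (λ s → statusDeg v s ≡ 0) (Fixed⇒status fixed) noFixedNbr)
        before : Keeps M (nbrs false b + nbrs true b) (nbrs false (not b) + nbrs true (not b))
        before = subst₂ (Keeps M) (Ncol-before b) (Ncol-before (not b)) (Fixed⇒Keeps G M c v fixed)
        after : Keeps M (nbrs false (not b) + nbrs true b) (nbrs false b + nbrs true (not b))
        after = subst₂ (Keeps M) (Ncol-after b) (Ncol-after-not b)
                  (subst (λ x → Keeps M (Ncol G c′ v x) (Ncol G c′ v (not x))) fixed
                    (Fixed⇒Keeps G M c′ v (trans period (sym fixed))))
        balanced : nbrs false b ≡ nbrs false (not b)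
        balanced = Keeps-crossed M before after
                     (trans (m+n≡0⇒m≡0 _ fixedNbrs≡0) (sym (m+n≡0⇒n≡0 _ fixedNbrs≡0)))
        deg≡ : deg G v ≡ nbrs false b + nbrs false b
        deg≡ = begin
          deg G v
            ≡⟨ deg-by-status v true ⟩
          statusDeg v true + statusDeg v false
            ≡⟨ cong₂ _+_ (statusDeg-by-colour true b) (statusDeg-by-colour false b) ⟩
          (nbrs true b + nbrs true (not b)) + (nbrs false b + nbrs false (not b))
            ≡⟨ cong₂ _+_ fixedNbrs≡0 (cong (nbrs false b +_) (sym balanced)) ⟩
          nbrs false b + nbrs false b
            ∎
          where open ≡-Reasoning

      toggle⇒odd-deg : ¬ Fixed G M c v → sameStatusDeg v ≤ 1 → sameStatusDeg v ≡ 1 × ¬ 2 ∣ deg G v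
      toggle⇒odd-deg toggle fewToggleNbrs =
        toggleNbrs≡1 , subst (λ d → ¬ 2 ∣ d) (sym deg≡) (odd-suc-double (nbrs true b))
        where
        b : Bool
        b = c v
        toggled : c′ v ≡ not b
        toggled = ¬-not toggle
        toggle′ : ¬ Fixed G M c′ v
        toggle′ fixed′ = not-¬ refl (trans (trans (sym period) fixed′) toggled)
        sameStatusDeg≡ : sameStatusDeg v ≡ nbrs false b + nbrs false (not b)
        sameStatusDeg≡ =
          trans (cong (statusDeg v) (¬Fixed⇒status toggle)) (statusDeg-by-colour false b)
        before : ¬ Keeps M (nbrs false b + nbrs true b) (nbrs false (not b) + nbrs true (not b))
        before = subst₂ (λ x y → ¬ Keeps M x y) (Ncol-before b) (Ncol-before (not b))
                   (¬Fixed⇒¬Keeps G M c v toggle)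
        after : ¬ Keeps M (nbrs false b + nbrs true (not b)) (nbrs false (not b) + nbrs true b)
        after = subst₂ (λ x y → ¬ Keeps M x y) (Ncol-after-not b)
                  (trans (cong (Ncol G c′ v) (not-involutive b)) (Ncol-after b))
                  (subst (λ x → ¬ Keeps M (Ncol G c′ v x) (Ncol G c′ v (not x))) toggled
                    (¬Fixed⇒¬Keeps G M c′ v toggle′))
        crossed : nbrs true b ≡ nbrs true (not b) × nbrs false b + nbrs false (not b) ≡ 1
        crossed = ¬Keeps-crossed M before after (subst (_≤ 1) sameStatusDeg≡ fewToggleNbrs)
        toggleNbrs≡1 : sameStatusDeg v ≡ 1
        toggleNbrs≡1 = trans sameStatusDeg≡ (proj₂ crossed)
        deg≡ : deg G v ≡ suc (nbrs true b + nbrs true b)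
        deg≡ = begin
          deg G v
            ≡⟨ deg-by-status v false ⟩
          statusDeg v false + statusDeg v true
            ≡⟨ cong₂ _+_ (statusDeg-by-colour false b) (statusDeg-by-colour true b) ⟩
          (nbrs false b + nbrs false (not b)) + (nbrs true b + nbrs true (not b))
            ≡⟨ cong₂ _+_ (proj₂ crossed) (cong (nbrs true b +_) (sym (proj₁ crossed))) ⟩
          suc (nbrs true b + nbrs true b)
            ∎
          where open ≡-Reasoning

      fixed? : Dec (Fixed G M c v)
      fixed? = apply G M c v ≟B c v

      isolated⇒fixed : sameStatusDeg v ≡ 0 → Fixed G M c v
      isolated⇒fixed isolated = decidable-stable fixed? λ toggle →
        0≢1+n (trans (sym isolated) (proj₁ (toggle⇒odd-deg toggle (subst (_≤ 1) (sym isolated) z≤n))))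

      even-deg⇒fixed : sameStatusDeg v ≤ 1 → 2 ∣ deg G v → Fixed G M c v
      even-deg⇒fixed few even =
        decidable-stable fixed? λ toggle → proj₂ (toggle⇒odd-deg toggle few) even

  block-nbr : ∀ {S v w} → IsBlock G M c S → T (S v) → T (adj G v w) → S w ≡ ⌊ st w ≟B st v ⌋
  block-nbr {v = v} {w} (_ , uniform , _ , closed) v∈S vw =
    T-⇔⇒≡ (λ w∈S → fromWitness (sym (uniform v w v∈S w∈S)))
          (λ same → closed v w v∈S vw (sym (toWitness same)))

  degIn-block : ∀ {S v} → IsBlock G M c S → T (S v) → degIn G S v ≡ sameStatusDeg v
  degIn-block blk v∈S =
    length-filterᵇ-cong (λ w → ∧-congˡ-T (block-nbr {w = w} blk v∈S)) (allFin n)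

  degIn-singleton : ∀ {S v} → (∀ x → T (S x) ⇔ x ≡ v) → degIn G S v ≡ 0
  degIn-singleton {S} {v} S≡｛v｝ = length-filterᵇ-none nbr∉S (allFin n)
    where
    nbr∉S : ∀ w → adj G v w ∧ S w ≡ false
    nbr∉S w with S w in w∈S
    ... | false = ∧-zeroʳ (adj G v w)
    ... | true with refl ← Equivalence.to (S≡｛v｝ w) (Equivalence.from T-≡ w∈S) =
      cong (_∧ true) (irrefl G v)

  walk-into-block : ∀ {S₁ S₂ a x} → IsBlock G M c S₁ → IsBlock G M c S₂ →
                    WalkIn G S₁ a x → T (S₂ a) → T (S₂ x)
  walk-into-block _ _ (here _) a∈S₂ = a∈S₂
  walk-into-block B₁@(_ , uniform₁ , _ , _) B₂@(_ , _ , _ , closed₂)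
                  (step {x = a} {y} a∈S₁ ay rest) a∈S₂ =
    walk-into-block B₁ B₂ rest (closed₂ a y a∈S₂ ay (uniform₁ a y a∈S₁ (start rest)))
    where
    start : ∀ {S y z} → WalkIn G S y z → T (S y)
    start (here y∈S)     = y∈S
    start (step y∈S _ _) = y∈S

  blocks-meet⇒equal : ∀ {S₁ S₂ w} → IsBlock G M c S₁ → IsBlock G M c S₂ →
                      T (S₁ w) → T (S₂ w) → ∀ x → S₁ x ≡ S₂ x
  blocks-meet⇒equal {w = w} B₁@(_ , _ , connected₁ , _) B₂@(_ , _ , connected₂ , _)
                    w∈S₁ w∈S₂ x =
    T-⇔⇒≡ (λ x∈S₁ → walk-into-block B₁ B₂ (connected₁ w x w∈S₁ x∈S₁) w∈S₂)
          (λ x∈S₂ → walk-into-block B₂ B₁ (connected₂ w x w∈S₂ x∈S₂) w∈S₁)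

  block-edge-status : ∀ {S₁ S₂ u w} → BlockEdge G M c S₁ S₂ u w → st u ≢ st w
  block-edge-status {u = u} {w} (B₁@(_ , _ , _ , closed₁) , B₂ , S₁≢S₂ , u∈S₁ , w∈S₂ , uw)
                    same =
    S₁≢S₂ (blocks-meet⇒equal B₁ B₂ (closed₁ u w u∈S₁ uw same) w∈S₂)

  fixed-block : ∀ {S v} → IsBlock G M c S → T (S v) → Fixed G M c v → FixedBlock G M c S
  fixed-block {v = v} (_ , uniform , _ , _) v∈S fixed x x∈S =
    toWitness (Equivalence.from T-≡ (trans (uniform x v x∈S v∈S) (Fixed⇒status v fixed)))

  module _ (period : ∀ v → apply G M c′ v ≡ c v) where

    status-changing-edge : ∀ {u w} → T (adj G u w) → st u ≢ st w →
                           (deg G u ≡ 2 → Fixed G M c u) × 2 ≤ deg G u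
    status-changing-edge {u} {w} uw st≢ = deg≡2⇒fixed , 2≤deg
      where
      otherStatusNbr : 1 ≤ statusDeg u (not (st u))
      otherStatusNbr = length-filterᵇ-pos _ (∈-allFin w)
                         (Equivalence.from T-∧ (uw , fromWitness (¬-not (st≢ ∘ sym))))
      same<deg : sameStatusDeg u < deg G u
      same<deg =
        subst (sameStatusDeg u <_) (sym (deg-by-status u (st u))) (m<m+n _ otherStatusNbr)
      deg≡2⇒fixed : deg G u ≡ 2 → Fixed G M c u
      deg≡2⇒fixed deg≡2 =
        even-deg⇒fixed u (period u) (s≤s⁻¹ (subst (sameStatusDeg u <_) deg≡2 same<deg))
                       (subst (2 ∣_) (sym deg≡2) (even-double 1))
      2≤deg : 2 ≤ deg G u
      2≤deg with 2 ≤? deg G u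
      ... | yes 2≤deg = 2≤deg
      ... | no 2≰deg =
        ⊥-elim (odd-suc-double 0 (subst (2 ∣_) deg≡1 (fixed⇒even-deg u (period u) fixed isolated)))
        where
        deg≤1 : deg G u ≤ 1
        deg≤1 = s≤s⁻¹ (≰⇒> 2≰deg)
        deg≡1 : deg G u ≡ 1
        deg≡1 = ≤-antisym deg≤1 (≤-trans (s≤s z≤n) same<deg)
        isolated : sameStatusDeg u ≡ 0
        isolated = n<1⇒n≡0 (<-≤-trans same<deg deg≤1)
        fixed : Fixed G M c u
        fixed = isolated⇒fixed u (period u) isolated

    block-edge-degrees : ∀ {S₁ S₂ u w} → BlockEdge G M c S₁ S₂ u w →
                         (deg G u ≡ 2 → Fixed G M c u) ×
                         2 ≤ deg G u ⊓ deg G w × 3 ≤ deg G u ⊔ deg G w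
    block-edge-degrees {u = u} {w} edge@(_ , _ , _ , _ , _ , uw) =
      proj₁ at-u , ⊓-glb (proj₂ at-u) (proj₂ at-w) , 3≤max
      where
      st≢ : st u ≢ st w
      st≢ = block-edge-status edge
      at-u : (deg G u ≡ 2 → Fixed G M c u) × 2 ≤ deg G u
      at-u = status-changing-edge uw st≢
      at-w : (deg G w ≡ 2 → Fixed G M c w) × 2 ≤ deg G w
      at-w = status-changing-edge (subst T (adjSym G u w) uw) (st≢ ∘ sym)
      -- two adjacent nodes of degree 2 would both be fixed
      3≤max : 3 ≤ deg G u ⊔ deg G w
      3≤max with 3 ≤? deg G u | 3 ≤? deg G w
      ... | yes 3≤u | _       = m≤n⇒m≤n⊔o (deg G w) 3≤u
      ... | no _    | yes 3≤w = m≤n⇒m≤o⊔n (deg G u) 3≤w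
      ... | no 3≰u  | no 3≰w  =
        ⊥-elim (st≢ (trans (Fixed⇒status u (proj₁ at-u (deg≡2 3≰u (proj₂ at-u))))
                           (sym (Fixed⇒status w (proj₁ at-w (deg≡2 3≰w (proj₂ at-w)))))))
        where
        deg≡2 : ∀ {d} → ¬ 3 ≤ d → 2 ≤ d → d ≡ 2
        deg≡2 3≰d 2≤d = ≤-antisym (s≤s⁻¹ (≰⇒> 3≰d)) 2≤d

    block-leaf-even-deg⇒fixed : ∀ {S v} → IsBlock G M c S → T (S v) →
                                degIn G S v ≡ 1 → 2 ∣ deg G v →
                                Fixed G M c v × FixedBlock G M c S
    block-leaf-even-deg⇒fixed {v = v} blk v∈S leaf even = fixed , fixed-block blk v∈S fixed
      where
      fixed : Fixed G M c v
      fixed =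
        even-deg⇒fixed v (period v) (≤-reflexive (trans (sym (degIn-block blk v∈S)) leaf)) even

    singleton-block⇒fixed : ∀ {S v} → IsBlock G M c S → (∀ x → T (S x) ⇔ x ≡ v) →
                            Fixed G M c v × FixedBlock G M c S × 2 ∣ deg G v
    singleton-block⇒fixed {S} {v} blk S≡｛v｝ =
      fixed , fixed-block blk v∈S fixed , fixed⇒even-deg v (period v) fixed isolated
      where
      v∈S : T (S v)
      v∈S = Equivalence.from (S≡｛v｝ v) refl
      isolated : sameStatusDeg v ≡ 0
      isolated = trans (sym (degIn-block blk v∈S)) (degIn-singleton S≡｛v｝)
      fixed : Fixed G M c v
      fixed = isolated⇒fixed v (period v) isolated

theorem23 : ∀ {n} (G : Graph n) → IsTree G → (M : Rule) (c : Coloring n) → InC2 G M c →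
    (∀ (S₁ S₂ : Fin n → Bool) (u w : Fin n) → BlockEdge G M c S₁ S₂ u w →
        (deg G u ≡ 2 → Fixed G M c u)
        × (2 ≤ deg G u ⊓ deg G w)
        × (3 ≤ deg G u ⊔ deg G w))
    × (∀ (S : Fin n → Bool) (v : Fin n) → IsBlock G M c S → T (S v) →
        degIn G S v ≡ 1 → 2 ∣ deg G v →
        Fixed G M c v × FixedBlock G M c S)
    × (∀ (S : Fin n → Bool) (v : Fin n) → IsBlock G M c S → (∀ x → T (S x) ⇔ x ≡ v) →
        Fixed G M c v × FixedBlock G M c S × 2 ∣ deg G v)
theorem23 G _ M c (_ , period) =
    (λ _ _ _ _ → block-edge-degrees G M c period)
  , (λ _ _ → block-leaf-even-deg⇒fixed G M c period)
  , (λ _ _ → singleton-block⇒fixed G M c period)
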